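{- Let $G$ be a signed graph on $n$ nodes with Gremban expansion $\mathcal{G}$ and Gremban Laplacian $\mathcal{L}$. Let $\psi\in\mathbb{R}^{2n}$ be an eigenvector of $\mathcal{L}$ all of whose entries are nonzero, and define $\mathcal{U}_1=\{a\in V(\mathcal{G}):\psi(a)>0\}$ and $\mathcal{U}_2=\{a\in V(\mathcal{G}):\psi(a)<0\}$. (i) If $\psi$ is symmetric, then the cut-set $C(\mathcal{U}_1,\mathcal{U}_2)$ is Gremban-symmetric and $\pi(C(\mathcal{U}_1,\mathcal{U}_2))$ is a cut-set of $G$. (ii) If $\psi$ is antisymmetric, then $C(\mathcal{U}_1,\mathcal{U}_2)$ is Gremban-symmetric and $\pi(C(\mathcal{U}_1,\mathcal{U}_2))$ is a frustration set of $G$.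
   Context: A signed graph $G=(V,E,\sigma)$ has a finite node set $V=\{1,\dots,n\}$, undirected edges without loops or multi-edges, and signs $\sigma:E\to\{\pm1\}$. Its Gremban expansion $\mathcal{G}$ is the unsigned graph on nodes $v^+,v^-$ ($v\in V$) with edges $(u^\chi,v^{\chi\sigma(u,v)})$ for each $(u,v)\in E$, $\chi\in\{\pm\}$. The Gremban involution is $\eta(v^\chi)=v^{ -\chi}$ (extended to edges and sets); a set $X$ is Gremban-symmetric if $\eta(X)=X$. The projection is $\pi(v^\chi)=v$, $\pi((u^\chi,v^\psi))=(u,v)$. Let $A^+$ (resp. $A^-$) be the $0/1$ adjacency matrix of the positive (resp. negative) edges of $G$ and $K$ the diagonal matrix of (unsigned) degrees. The Gremban Laplacian is the $2n\times 2n$ matrix $\mathcal{L}=\begin{pmatrix}K-A^+ & -A^-\\ -A^- & K-A^+\end{pmatrix}$, with coordinates indexed by $v^+$ (first block) and $v^-$ (second block); it is the Laplacian of $\mathcal{G}$. A vector $\psi\in\mathbb{R}^{2n}$ is symmetric if $\psi=(\mathbf{x},\mathbf{x})^\top$ and antisymmetric if $\psi=(\mathbf{x},-\mathbf{x})^\top$ for some $\mathbf{x}\in\mathbb{R}^n$. For a partition $S\cup T$ of the nodes, $C(S,T)$ is the set of edges with one end in $S$ and one in $T$; a cut-set of $G$ is any $C(S,T)$ with $V=S\cup T$. A frustration set of $G$ is any $F(\theta)=\{uv\in E:\theta(u)\theta(v)\sigma(uv)=-1\}$ for a switching function $\theta:V\to\{\pm1\}$. -}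

module Defs where

open import Data.Nat using (ℕ; zero; suc)
open import Data.Fin using (Fin)
import Data.Fin as Fin
open import Data.Maybe using (Maybe; just; nothing)
open import Data.Product using (Σ; ∃; ∃-syntax; _×_; _,_)
open import Data.Sum using (_⊎_)
open import Relation.Binary.PropositionalEquality using (_≡_; _≢_)
open import Relation.Nullary using (¬_; yes; no)
open import Function.Bundles using (_⇔_)

-- The real numbers, axiomatised as a complete ordered field.
-- (agda-stdlib has no real numbers; the theorem is stated for every
-- structure satisfying these axioms, i.e. for ℝ up to isomorphism.)

record RealField : Set₁ where
  infixl 6 _+_
  infixl 7 _*_
  infix 4 _<_ _≤_
  field
    ℝ    : Set
    0r 1r : ℝ
    _+_ _*_ : ℝ → ℝ → ℝ
    -_   : ℝ → ℝ
    _<_  : ℝ → ℝ → Set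
    +-assoc : ∀ x y z → (x + y) + z ≡ x + (y + z)
    +-comm  : ∀ x y → x + y ≡ y + x
    +-identityʳ : ∀ x → x + 0r ≡ x
    +-inverseʳ  : ∀ x → x + (- x) ≡ 0r
    *-assoc : ∀ x y z → (x * y) * z ≡ x * (y * z)
    *-comm  : ∀ x y → x * y ≡ y * x
    *-identityʳ : ∀ x → x * 1r ≡ x
    distribˡ : ∀ x y z → x * (y + z) ≡ x * y + x * z
    0≢1 : 0r ≢ 1r
    *-inverse : ∀ x → x ≢ 0r → ∃[ y ] (x * y ≡ 1r)
    <-irrefl : ∀ x → ¬ (x < x)
    <-trans  : ∀ {x y z} → x < y → y < z → x < z
    <-trichotomy : ∀ x y → x < y ⊎ x ≡ y ⊎ y < x
    +-mono-< : ∀ {x y} z → x < y → x + z < y + z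
    *-pos    : ∀ {x y} → 0r < x → 0r < y → 0r < x * y
  _≤_ : ℝ → ℝ → Set
  x ≤ y = x < y ⊎ x ≡ y
  field
    complete : (P : ℝ → Set) → (∃[ x ] P x) → (∃[ b ] (∀ x → P x → x ≤ b)) →
               ∃[ s ] ((∀ x → P x → x ≤ s) × (∀ b → (∀ x → P x → x ≤ b) → s ≤ b))

  _-_ : ℝ → ℝ → ℝ
  x - y = x + (- y)

  fromℕ : ℕ → ℝ
  fromℕ zero = 0r
  fromℕ (suc k) = 1r + fromℕ k

  Σ[_] : ∀ {n} → (Fin n → ℝ) → ℝ
  Σ[_] {zero} f = 0r
  Σ[_] {suc n} f = f Fin.zero + Σ[_] (λ i → f (Fin.suc i))

data Sign : Set where
  pos neg : Sign

_·ₛ_ : Sign → Sign → Sign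
pos ·ₛ s = s
neg ·ₛ pos = neg
neg ·ₛ neg = pos

-- A signed graph on nodes Fin n: E u v = just s iff uv is an edge of sign s.
record SignedGraph (n : ℕ) : Set where
  field
    E        : Fin n → Fin n → Maybe Sign
    E-sym    : ∀ u v → E u v ≡ E v u
    loopless : ∀ u → E u u ≡ nothing

module _ {n : ℕ} (G : SignedGraph n) where
  open SignedGraph G

  Edge : Fin n → Fin n → Set
  Edge u v = ∃[ s ] (E u v ≡ just s)

  -- nodes of the Gremban expansion: v^χ = (v , χ)
  GNode : Set
  GNode = Fin n × Sign

  -- Gremban expansion: edges (u^χ, v^{χσ(uv)})
  GEdge : GNode → GNode → Set
  GEdge (u , χ) (v , ψ) = ∃[ s ] (E u v ≡ just s × ψ ≡ χ ·ₛ s)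

  η : GNode → GNode
  η (v , pos) = (v , neg)
  η (v , neg) = (v , pos)

  GrembanSymmetric : (GNode → GNode → Set) → Set
  GrembanSymmetric X = ∀ a b → X a b ⇔ X (η a) (η b)

  GCut : (GNode → Set) → (GNode → Set) → GNode → GNode → Set
  GCut U₁ U₂ a b = GEdge a b × ((U₁ a × U₂ b) ⊎ (U₂ a × U₁ b))

  proj : (GNode → GNode → Set) → Fin n → Fin n → Set
  proj X u v = ∃[ χ ] ∃[ ψ ] X (u , χ) (v , ψ)

  IsCutSet : (Fin n → Fin n → Set) → Set₁
  IsCutSet X = Σ (Fin n → Set) λ S → Σ (Fin n → Set) λ T →
    ((∀ v → S v ⊎ T v) × (∀ v → ¬ (S v × T v)) ×
     (∀ u v → X u v ⇔ (Edge u v × ((S u × T v) ⊎ (T u × S v)))))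

  IsFrustrationSet : (Fin n → Fin n → Set) → Set
  IsFrustrationSet X = Σ (Fin n → Sign) λ θ →
    (∀ u v → X u v ⇔ (∃[ s ] (E u v ≡ just s × ((θ u ·ₛ θ v) ·ₛ s) ≡ neg)))

  module _ (R : RealField) where
    open RealField R

    isPos isNeg : Maybe Sign → ℝ
    isPos (just pos) = 1r
    isPos _ = 0r
    isNeg (just neg) = 1r
    isNeg _ = 0r

    A⁺ A⁻ : Fin n → Fin n → ℝ
    A⁺ u v = isPos (E u v)
    A⁻ u v = isNeg (E u v)

    degℕ : Fin n → ℕ
    degℕ v = count (λ u → E v u)
      where
      cnt : ∀ {m} → (Fin m → Maybe Sign) → ℕ
      cnt {zero} f = zero
      cnt {suc m} f with f Fin.zero
      ... | just _  = suc (cnt (λ i → f (Fin.suc i)))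
      ... | nothing = cnt (λ i → f (Fin.suc i))
      count : (Fin n → Maybe Sign) → ℕ
      count = cnt

    Kdiag : Fin n → Fin n → ℝ
    Kdiag u v with u Fin.≟ v
    ... | yes _ = fromℕ (degℕ u)
    ... | no _  = 0r

    -- Gremban Laplacian [[K - A⁺, -A⁻], [-A⁻, K - A⁺]]
    𝓛 : GNode → GNode → ℝ
    𝓛 (u , pos) (v , pos) = Kdiag u v - A⁺ u v
    𝓛 (u , neg) (v , neg) = Kdiag u v - A⁺ u v
    𝓛 (u , pos) (v , neg) = - A⁻ u v
    𝓛 (u , neg) (v , pos) = - A⁻ u v

    𝓛· : (GNode → ℝ) → GNode → ℝ
    𝓛· φ a = Σ[ (λ v → 𝓛 a (v , pos) * φ (v , pos) + 𝓛 a (v , neg) * φ (v , neg)) ]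

    IsEigenvector : (GNode → ℝ) → Set
    IsEigenvector φ = ¬ (∀ a → φ a ≡ 0r) × ∃[ λ' ] (∀ a → 𝓛· φ a ≡ λ' * φ a)

    IsSymmetricVec IsAntisymmetricVec : (GNode → ℝ) → Set
    IsSymmetricVec φ = Σ (Fin n → ℝ) λ x → (∀ v → φ (v , pos) ≡ x v × φ (v , neg) ≡ x v)
    IsAntisymmetricVec φ = Σ (Fin n → ℝ) λ x → (∀ v → φ (v , pos) ≡ x v × φ (v , neg) ≡ - x v)

    U₁ U₂ : (GNode → ℝ) → GNode → Set
    U₁ φ a = 0r < φ a
    U₂ φ a = φ a < 0r

-- Label each node a of the Gremban expansion by the sign of ψ(a); an
-- edge of 𝒢 is cut exactly when the product of the labels of its ends is negative. For a
-- symmetric ψ the label of v^χ is a switching function θ(v) independent of χ, so an edge is cut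
-- iff θ differs at the ends of its projection, which is the cut-set C(θ⁻¹(+), θ⁻¹(−)). For an
-- antisymmetric ψ the label of v^χ is χ θ(v); along an edge (u^χ, v^{χσ(uv)}) the product of
-- labels is θ(u) θ(v) σ(uv), so the projected cut is the frustration set F(θ). In both cases η
-- multiplies every label by the same sign, which leaves products of labels unchanged.
module Submission where

open import Defs
open import Data.Nat using (ℕ)
open import Data.Fin using (Fin)
open import Data.Maybe using (just)
open import Data.Product using (_×_; _,_; proj₁; proj₂; ∃-syntax)
open import Data.Sum using (_⊎_; inj₁; inj₂)
open import Function using (_∘_)
open import Function.Bundles using (_⇔_; mk⇔; Equivalence)
import Function.Properties.Equivalence as ⇔
open import Relation.Binary.PropositionalEquality
  using (_≡_; _≢_; refl; sym; trans; cong; cong₂; subst₂; module ≡-Reasoning)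
open import Relation.Nullary using (¬_; contradiction)

open Equivalence using (to; from)

·ₛ-assoc : ∀ x y z → (x ·ₛ y) ·ₛ z ≡ x ·ₛ (y ·ₛ z)
·ₛ-assoc pos y   z   = refl
·ₛ-assoc neg pos z   = refl
·ₛ-assoc neg neg pos = refl
·ₛ-assoc neg neg neg = refl

·ₛ-comm : ∀ x y → x ·ₛ y ≡ y ·ₛ x
·ₛ-comm pos pos = refl
·ₛ-comm pos neg = refl
·ₛ-comm neg pos = refl
·ₛ-comm neg neg = refl

·ₛ-cancelˡ : ∀ c x y → (c ·ₛ x) ·ₛ (c ·ₛ y) ≡ x ·ₛ y
·ₛ-cancelˡ pos x   y   = refl
·ₛ-cancelˡ neg pos pos = refl
·ₛ-cancelˡ neg pos neg = refl
·ₛ-cancelˡ neg neg pos = refl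
·ₛ-cancelˡ neg neg neg = refl

·ₛ≡neg⇔ : ∀ {x y} → x ·ₛ y ≡ neg ⇔ ((x ≡ pos × y ≡ neg) ⊎ (x ≡ neg × y ≡ pos))
·ₛ≡neg⇔ {x} {y} = mk⇔ ⇒ ⇐
  where
  ⇒ : ∀ {x y} → x ·ₛ y ≡ neg → (x ≡ pos × y ≡ neg) ⊎ (x ≡ neg × y ≡ pos)
  ⇒ {pos} {neg} _ = inj₁ (refl , refl)
  ⇒ {neg} {pos} _ = inj₂ (refl , refl)
  ⇐ : (x ≡ pos × y ≡ neg) ⊎ (x ≡ neg × y ≡ pos) → x ·ₛ y ≡ neg
  ⇐ (inj₁ (refl , refl)) = refl
  ⇐ (inj₂ (refl , refl)) = refl

·ₛ-alongEdge : ∀ χ s a b → (χ ·ₛ a) ·ₛ ((χ ·ₛ s) ·ₛ b) ≡ (a ·ₛ b) ·ₛ s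
·ₛ-alongEdge χ s a b = begin
  (χ ·ₛ a) ·ₛ ((χ ·ₛ s) ·ₛ b)  ≡⟨ cong ((χ ·ₛ a) ·ₛ_) (·ₛ-assoc χ s b) ⟩
  (χ ·ₛ a) ·ₛ (χ ·ₛ (s ·ₛ b))  ≡⟨ ·ₛ-cancelˡ χ a (s ·ₛ b) ⟩
  a ·ₛ (s ·ₛ b)                ≡⟨ cong (a ·ₛ_) (·ₛ-comm s b) ⟩
  a ·ₛ (b ·ₛ s)                ≡⟨ sym (·ₛ-assoc a b s) ⟩
  (a ·ₛ b) ·ₛ s                ∎
  where open ≡-Reasoning

module RealSigns (R : RealField) where
  open RealField R

  +-identityˡ : ∀ x → 0r + x ≡ x
  +-identityˡ x = trans (+-comm 0r x) (+-identityʳ x)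

  <-asym : ∀ {x y} → x < y → ¬ y < x
  <-asym {x} x<y y<x = <-irrefl x (<-trans x<y y<x)

  neg-<0 : ∀ {x} → 0r < x → - x < 0r
  neg-<0 {x} 0<x = subst₂ _<_ (+-identityˡ (- x)) (+-inverseʳ x) (+-mono-< (- x) 0<x)

  neg->0 : ∀ {x} → x < 0r → 0r < - x
  neg->0 {x} x<0 = subst₂ _<_ (+-inverseʳ x) (+-identityˡ (- x)) (+-mono-< (- x) x<0)

  -- 0r is sent to neg; every use below is at a nonzero argument.
  sign : ℝ → Sign
  sign x with <-trichotomy 0r x
  ... | inj₁ _ = pos
  ... | inj₂ _ = neg

  sign-pos : ∀ {x} → 0r < x → sign x ≡ pos
  sign-pos {x} 0<x with <-trichotomy 0r x
  ... | inj₁ _            = refl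
  ... | inj₂ (inj₁ refl)  = contradiction 0<x (<-irrefl 0r)
  ... | inj₂ (inj₂ x<0)   = contradiction x<0 (<-asym 0<x)

  sign-neg : ∀ {x} → x < 0r → sign x ≡ neg
  sign-neg {x} x<0 with <-trichotomy 0r x
  ... | inj₁ 0<x = contradiction x<0 (<-asym 0<x)
  ... | inj₂ _   = refl

  nonzero-split : ∀ {x} → x ≢ 0r → 0r < x ⊎ x < 0r
  nonzero-split {x} x≢0 with <-trichotomy 0r x
  ... | inj₁ 0<x           = inj₁ 0<x
  ... | inj₂ (inj₁ 0≡x)   = contradiction (sym 0≡x) x≢0
  ... | inj₂ (inj₂ x<0)   = inj₂ x<0

  sign-negate : ∀ {x} → x ≢ 0r → sign (- x) ≡ neg ·ₛ sign x
  sign-negate x≢0 with nonzero-split x≢0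
  ... | inj₁ 0<x = trans (sign-neg (neg-<0 0<x)) (cong (neg ·ₛ_) (sym (sign-pos 0<x)))
  ... | inj₂ x<0 = trans (sign-pos (neg->0 x<0)) (cong (neg ·ₛ_) (sym (sign-neg x<0)))

  opposite-signs⇔ : ∀ {x y} → x ≢ 0r → y ≢ 0r →
                    ((0r < x × y < 0r) ⊎ (x < 0r × 0r < y)) ⇔ sign x ·ₛ sign y ≡ neg
  opposite-signs⇔ {x} {y} x≢0 y≢0 = mk⇔ ⇒ (⇐ (nonzero-split x≢0) (nonzero-split y≢0))
    where
    ⇒ : (0r < x × y < 0r) ⊎ (x < 0r × 0r < y) → sign x ·ₛ sign y ≡ neg
    ⇒ (inj₁ (0<x , y<0)) = cong₂ _·ₛ_ (sign-pos 0<x) (sign-neg y<0)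
    ⇒ (inj₂ (x<0 , 0<y)) = cong₂ _·ₛ_ (sign-neg x<0) (sign-pos 0<y)
    ⇐ : 0r < x ⊎ x < 0r → 0r < y ⊎ y < 0r → sign x ·ₛ sign y ≡ neg →
        (0r < x × y < 0r) ⊎ (x < 0r × 0r < y)
    ⇐ (inj₁ 0<x) (inj₂ y<0) _ = inj₁ (0<x , y<0)
    ⇐ (inj₂ x<0) (inj₁ 0<y) _ = inj₂ (x<0 , 0<y)
    ⇐ (inj₁ 0<x) (inj₁ 0<y) h = contradiction (trans (sym (cong₂ _·ₛ_ (sign-pos 0<x) (sign-pos 0<y))) h) λ ()
    ⇐ (inj₂ x<0) (inj₂ y<0) h = contradiction (trans (sym (cong₂ _·ₛ_ (sign-neg x<0) (sign-neg y<0))) h) λ ()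

module SignCuts {n : ℕ} (G : SignedGraph n) where
  open SignedGraph G

  record SignCut (ℓ : GNode G → Sign) (a b : GNode G) : Set where
    constructor signCut
    field
      edge     : GEdge G a b
      opposite : ℓ a ·ₛ ℓ b ≡ neg

  symmetricLabel antisymmetricLabel : (Fin n → Sign) → GNode G → Sign
  symmetricLabel θ (v , χ) = θ v
  antisymmetricLabel θ (v , χ) = χ ·ₛ θ v

  η-flip : ∀ v χ → η G (v , χ) ≡ (v , neg ·ₛ χ)
  η-flip v pos = refl
  η-flip v neg = refl

  η-involutive : ∀ a → η G (η G a) ≡ a
  η-involutive (v , pos) = refl
  η-involutive (v , neg) = refl

  module _ {ℓ : GNode G → Sign} (c : Sign) (ℓ-η : ∀ v χ → ℓ (v , neg ·ₛ χ) ≡ c ·ₛ ℓ (v , χ)) where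

    signCut-η : ∀ a b → SignCut ℓ a b → SignCut ℓ (η G a) (η G b)
    signCut-η (u , χ) (v , χ') (signCut (s , e , χ'≡χs) cut) rewrite η-flip u χ | η-flip v χ' =
      signCut (s , e , trans (cong (neg ·ₛ_) χ'≡χs) (sym (·ₛ-assoc neg χ s)))
      (begin
        ℓ (u , neg ·ₛ χ) ·ₛ ℓ (v , neg ·ₛ χ')       ≡⟨ cong₂ _·ₛ_ (ℓ-η u χ) (ℓ-η v χ') ⟩
        (c ·ₛ ℓ (u , χ)) ·ₛ (c ·ₛ ℓ (v , χ'))       ≡⟨ ·ₛ-cancelˡ c (ℓ (u , χ)) (ℓ (v , χ')) ⟩
        ℓ (u , χ) ·ₛ ℓ (v , χ')                     ≡⟨ cut ⟩
        neg                                         ∎)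
      where open ≡-Reasoning

  grembanSymmetric-signCut : ∀ {X ℓ} → (∀ a b → X a b ⇔ SignCut ℓ a b) →
                             (c : Sign) → (∀ v χ → ℓ (v , neg ·ₛ χ) ≡ c ·ₛ ℓ (v , χ)) →
                             GrembanSymmetric G X
  grembanSymmetric-signCut {X} X⇔ c ℓ-η a b = mk⇔ (η-closed a b) λ Xηaηb →
    subst₂ X (η-involutive a) (η-involutive b) (η-closed (η G a) (η G b) Xηaηb)
    where
    η-closed : ∀ a b → X a b → X (η G a) (η G b)
    η-closed a b = from (X⇔ (η G a) (η G b)) ∘ signCut-η c ℓ-η a b ∘ to (X⇔ a b)

  isCutSet-proj : ∀ {X θ} → (∀ a b → X a b ⇔ SignCut (symmetricLabel θ) a b) → IsCutSet G (proj G X)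
  isCutSet-proj {X} {θ} X⇔ = S , T , S⊎T , ¬S×T , projX⇔
    where
    S T : Fin n → Set
    S v = θ v ≡ pos
    T v = θ v ≡ neg

    S⊎T : ∀ v → S v ⊎ T v
    S⊎T v with θ v
    ... | pos = inj₁ refl
    ... | neg = inj₂ refl

    ¬S×T : ∀ v → ¬ (S v × T v)
    ¬S×T v (θv≡pos , θv≡neg) = contradiction (trans (sym θv≡pos) θv≡neg) λ ()

    projX⇔ : ∀ u v → proj G X u v ⇔ (Edge G u v × ((S u × T v) ⊎ (T u × S v)))
    projX⇔ u v = mk⇔ ⇒ ⇐
      where
      ⇒ : proj G X u v → Edge G u v × ((S u × T v) ⊎ (T u × S v))
      ⇒ (χ , χ' , Xuv) with to (X⇔ (u , χ) (v , χ')) Xuv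
      ... | signCut (s , e , _) cut = (s , e) , to ·ₛ≡neg⇔ cut
      ⇐ : Edge G u v × ((S u × T v) ⊎ (T u × S v)) → proj G X u v
      ⇐ ((s , e) , ST) = pos , s , from (X⇔ (u , pos) (v , s)) (signCut (s , e , refl) (from ·ₛ≡neg⇔ ST))

  isFrustrationSet-proj : ∀ {X θ} → (∀ a b → X a b ⇔ SignCut (antisymmetricLabel θ) a b) →
                          IsFrustrationSet G (proj G X)
  isFrustrationSet-proj {X} {θ} X⇔ = θ , projX⇔
    where
    projX⇔ : ∀ u v → proj G X u v ⇔ (∃[ s ] (E u v ≡ just s × ((θ u ·ₛ θ v) ·ₛ s) ≡ neg))
    projX⇔ u v = mk⇔ ⇒ ⇐
      where
      ⇒ : proj G X u v → ∃[ s ] (E u v ≡ just s × ((θ u ·ₛ θ v) ·ₛ s) ≡ neg)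
      ⇒ (χ , χ' , Xuv) with to (X⇔ (u , χ) (v , χ')) Xuv
      ... | signCut (s , e , refl) cut = s , e , trans (sym (·ₛ-alongEdge χ s (θ u) (θ v))) cut
      ⇐ : ∃[ s ] (E u v ≡ just s × ((θ u ·ₛ θ v) ·ₛ s) ≡ neg) → proj G X u v
      ⇐ (s , e , frustrated) = pos , s ,
        from (X⇔ (u , pos) (v , s)) (signCut (s , e , refl) (trans (·ₛ-alongEdge pos s (θ u) (θ v)) frustrated))

module _ (R : RealField) {n : ℕ} (G : SignedGraph n) where
  open RealField R
  open RealSigns R
  open SignCuts G

  gcut⇔signCut : ∀ {φ ℓ} → (∀ a → φ a ≢ 0r) → (∀ a → sign (φ a) ≡ ℓ a) →
                 ∀ a b → GCut G (U₁ G R φ) (U₂ G R φ) a b ⇔ SignCut ℓ a b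
  gcut⇔signCut {φ} {ℓ} φ≢0 sign≡ℓ a b = mk⇔
    (λ (e , opp) → signCut e (to signs⇔ opp))
    (λ (signCut e opp) → e , from signs⇔ opp)
    where
    relabel : sign (φ a) ·ₛ sign (φ b) ≡ ℓ a ·ₛ ℓ b
    relabel = cong₂ _·ₛ_ (sign≡ℓ a) (sign≡ℓ b)
    signs⇔ : ((0r < φ a × φ b < 0r) ⊎ (φ a < 0r × 0r < φ b)) ⇔ ℓ a ·ₛ ℓ b ≡ neg
    signs⇔ = ⇔.trans (opposite-signs⇔ (φ≢0 a) (φ≢0 b)) (mk⇔ (trans (sym relabel)) (trans relabel))

  sign-symmetricVec : ∀ {φ} → (φ-sym : IsSymmetricVec G R φ) →
                      ∀ a → sign (φ a) ≡ symmetricLabel (sign ∘ proj₁ φ-sym) a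
  sign-symmetricVec (x , φ≡x) (v , pos) = cong sign (proj₁ (φ≡x v))
  sign-symmetricVec (x , φ≡x) (v , neg) = cong sign (proj₂ (φ≡x v))

  sign-antisymmetricVec : ∀ {φ} → (∀ a → φ a ≢ 0r) → (φ-antisym : IsAntisymmetricVec G R φ) →
                          ∀ a → sign (φ a) ≡ antisymmetricLabel (sign ∘ proj₁ φ-antisym) a
  sign-antisymmetricVec φ≢0 (x , φ≡±x) (v , pos) = cong sign (proj₁ (φ≡±x v))
  sign-antisymmetricVec φ≢0 (x , φ≡±x) (v , neg) =
    trans (cong sign (proj₂ (φ≡±x v))) (sign-negate λ xv≡0 → φ≢0 (v , pos) (trans (proj₁ (φ≡±x v)) xv≡0))

theorem4 : (R : RealField) → (n : ℕ) → (G : SignedGraph n) →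
    (ψ : GNode G → RealField.ℝ R) →
    IsEigenvector G R ψ →
    (∀ a → ψ a ≢ RealField.0r R) →
    ((IsSymmetricVec G R ψ →
    GrembanSymmetric G (GCut G (U₁ G R ψ) (U₂ G R ψ)) ×
    IsCutSet G (proj G (GCut G (U₁ G R ψ) (U₂ G R ψ))))
    × (IsAntisymmetricVec G R ψ →
    GrembanSymmetric G (GCut G (U₁ G R ψ) (U₂ G R ψ)) ×
    IsFrustrationSet G (proj G (GCut G (U₁ G R ψ) (U₂ G R ψ)))))
theorem4 R n G ψ _ ψ≢0 =
  (λ ψ-sym → let cut⇔ = gcut⇔signCut R G ψ≢0 (sign-symmetricVec R G ψ-sym) in
    grembanSymmetric-signCut cut⇔ pos (λ _ _ → refl) , isCutSet-proj cut⇔) ,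
  (λ ψ-antisym → let cut⇔ = gcut⇔signCut R G ψ≢0 (sign-antisymmetricVec R G ψ≢0 ψ-antisym) in
    grembanSymmetric-signCut cut⇔ neg (λ v χ → ·ₛ-assoc neg χ _) , isFrustrationSet-proj cut⇔)
  where open SignCuts G
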